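{- Let $1\le s<n$ be integers and $0<m<\binom{n}{s}$, and let $m=[n_s,n_{s-1},\dots,n_{s-\ell+1}]_s$ be the strict $s$-cascade representation of $m$. Put $b=n_{s-\ell+1}$. Then the strict $(n-s)$-cascade representation of $m'=\binom{n}{s}-m$ is $m'=[n'_{n-s},n'_{n-s-1},\dots,n'_{n-s-k+1}]_{n-s}$, where $n'_{n-s-k+1}=b$ and the sets satisfy \[ \{b,n_{s-\ell+2},\dots,n_s\}\cup\{b,n'_{n-s-k+2},\dots,n'_{n-s}\}=\{b,b+1,\dots,n-1\},\qquad \{b,n_{s-\ell+2},\dots,n_s\}\cap\{b,n'_{n-s-k+2},\dots,n'_{n-s}\}=\{b\}. \] In particular $k+\ell-1=n-b$, i.e. $k=n-\ell-b+1$.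
   Context: For a strictly decreasing integer sequence $(n_s,n_{s-1},\dots,n_{s-\ell+1})$ and integer $j$, $[n_s,\dots,n_{s-\ell+1}]_j=\sum_{k=0}^{\ell-1}\binom{n_{s-k}}{j-k}$. The sequence is a strict $s$-cascade if $\ell\le s$ and $n_{s-k}\ge s-k$ for $0\le k\le\ell-1$. Every integer $m\ge 0$ has a unique representation $m=[n_s,\dots,n_{s-\ell+1}]_s$ with $(n_s,\dots,n_{s-\ell+1})$ a strict $s$-cascade, called the strict $s$-cascade representation of $m$. -}

module Defs where

open import Data.Nat using (ℕ; zero; suc; _+_; _≤_; _<_; _>_)
open import Data.Nat.Combinatorics using (_C_)
open import Data.List using (List; []; _∷_; length)
open import Data.List.Relation.Unary.Linked using (Linked)
open import Data.Product using (_×_)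
open import Data.Unit using (⊤)

-- [n_s, n_{s-1}, ..., n_{s-ℓ+1}]_j = Σ_{k=0}^{ℓ-1} binom(n_{s-k}, j-k),
-- the list is (n_s ∷ n_{s-1} ∷ ... ∷ n_{s-ℓ+1} ∷ []).
-- Terms with negative lower index j-k < 0 are 0 (handled by cascadeRest).
cascadeVal : ℕ → List ℕ → ℕ
cascadeRest : ℕ → List ℕ → ℕ
cascadeVal j [] = 0
cascadeVal j (x ∷ xs) = x C j + cascadeRest j xs
cascadeRest zero xs = 0
cascadeRest (suc j) xs = cascadeVal j xs

-- n_{s-k} ≥ s-k for every position k (0 ≤ k ≤ ℓ-1), together with ℓ ≤ s
-- (a nonempty tail when the index has reached 0 is impossible).
LowerBounds : ℕ → List ℕ → Set
LowerBounds s [] = ⊤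
LowerBounds zero (x ∷ xs) = Data.Empty.⊥
  where import Data.Empty
LowerBounds (suc t) (x ∷ xs) = suc t ≤ x × LowerBounds t xs

StrictCascade : ℕ → List ℕ → Set
StrictCascade s ns = Linked _>_ ns × length ns ≤ s × LowerBounds s ns

{-# OPTIONS --safe #-}
-- Induct on n with Pascal's rule C(n, s) = C(n-1, s-1) + C(n-1, s). If the top entry of
-- the s-cascade of m is n-1, dropping it leaves an (s-1)-cascade of m - C(n-1, s) inside
-- C(n-1, s-1), with the same complement cascade. Otherwise the cascade lies below n-1, and
-- prepending n-1 to the complement of m in C(n-1, s) gives its complement in C(n, s),
-- because C(n-1, n-s) = C(n-1, s-1). So every value n-1 > b is used by exactly one of the
-- two cascades, and the recursion ends at the cascade [b], which is its own complement.
-- Uniqueness of strict cascade representations identifies the constructed complement.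
module Submission where

open import Defs
open import Data.Nat using (ℕ; zero; suc; _+_; _∸_; _≤_; _<_; _>_; z≤n; s≤s; _≤?_; pred)
open import Data.Nat.Properties
open import Data.Nat.Combinatorics using (_C_; nCk≡nC[n∸k]; nCk+nC[k+1]≡[n+1]C[k+1])
open import Data.List using (List; []; _∷_; length; _∷ʳ_)
open import Data.List.Membership.Propositional using (_∈_)
open import Data.List.Membership.Propositional.Properties using (∈-++⁺ʳ)
open import Data.List.Relation.Unary.Any using (here; there)
open import Data.List.Relation.Unary.Linked using (Linked; []; [-]; _∷_)
import Data.List.Relation.Unary.Linked as Linked
open import Data.Product using (_×_; ∃; _,_; proj₁; proj₂)
open import Data.Sum using (_⊎_; inj₁; inj₂)
import Data.Sum as Sum
open import Data.Unit using (tt)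
open import Function.Bundles using (_⇔_; mk⇔; Equivalence)
open import Relation.Binary.PropositionalEquality
  using (_≡_; refl; sym; trans; cong; cong₂; subst; module ≡-Reasoning)
open import Relation.Binary.Definitions using (tri<; tri≈; tri>)
open import Relation.Nullary using (yes; no; contradiction)

open Equivalence using (to; from)

C-positive : ∀ n k → k ≤ n → 0 < n C k
C-positive n zero _ = s≤s z≤n
C-positive (suc n) (suc k) (s≤s k≤n) =
  subst (0 <_) (nCk+nC[k+1]≡[n+1]C[k+1] n k) (<-≤-trans (C-positive n k k≤n) (m≤m+n _ _))

C-monoˡ-≤ : ∀ k {m n} → m ≤ n → m C k ≤ n C k
C-monoˡ-≤ k {m} m≤n with m≤n⇒m<n∨m≡n m≤n
... | inj₂ refl = ≤-refl
... | inj₁ (s≤s {n = n} m≤n) = ≤-trans (C-monoˡ-≤ k m≤n) (step k)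
  where
  step : ∀ k → n C k ≤ suc n C k
  step zero = ≤-refl
  step (suc k) = subst (n C suc k ≤_) (nCk+nC[k+1]≡[n+1]C[k+1] n k) (m≤n+m _ _)

cascadeVal-head : ∀ j x xs → x C j ≤ cascadeVal j (x ∷ xs)
cascadeVal-head j x xs = m≤m+n (x C j) (cascadeRest j xs)

cascadeVal-positive : ∀ j x xs → LowerBounds j (x ∷ xs) → 0 < cascadeVal j (x ∷ xs)
cascadeVal-positive (suc t) x xs (t<x , _) =
  <-≤-trans (C-positive x (suc t) t<x) (cascadeVal-head (suc t) x xs)

cascadeVal<C : ∀ t y xs → t ≤ y → Linked _>_ (y ∷ xs) → LowerBounds t xs → cascadeVal t xs < y C t
cascadeVal<C t y [] t≤y _ _ = C-positive y t t≤y
cascadeVal<C (suc t) y (x ∷ xs) _ y>x∷xs (t<x , lb) = begin-strict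
  x C suc t + cascadeVal t xs
    <⟨ +-monoʳ-< (x C suc t) (cascadeVal<C t x xs (<⇒≤ t<x) (Linked.tail y>x∷xs) lb) ⟩
  x C suc t + x C t            ≡⟨ trans (+-comm (x C suc t) (x C t)) (nCk+nC[k+1]≡[n+1]C[k+1] x t) ⟩
  suc x C suc t                ≤⟨ C-monoˡ-≤ (suc t) (Linked.head y>x∷xs) ⟩
  y C suc t                    ∎
  where open ≤-Reasoning

cascadeVal-<-head : ∀ j x xs y ys → Linked _>_ (x ∷ xs) → LowerBounds j (x ∷ xs) → x < y →
  cascadeVal j (x ∷ xs) < cascadeVal j (y ∷ ys)
cascadeVal-<-head (suc t) x xs y ys x>xs lb x<y = begin-strict
  cascadeVal (suc t) (x ∷ xs)
    <⟨ cascadeVal<C (suc t) (suc x) (x ∷ xs) (m≤n⇒m≤1+n (proj₁ lb)) (≤-refl ∷ x>xs) lb ⟩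
  suc x C suc t                ≤⟨ C-monoˡ-≤ (suc t) x<y ⟩
  y C suc t                    ≤⟨ cascadeVal-head (suc t) y ys ⟩
  cascadeVal (suc t) (y ∷ ys)  ∎
  where open ≤-Reasoning

cascadeVal-injective : ∀ j xs ys → Linked _>_ xs → LowerBounds j xs →
  Linked _>_ ys → LowerBounds j ys → cascadeVal j xs ≡ cascadeVal j ys → xs ≡ ys
cascadeVal-injective j [] [] _ _ _ _ _ = refl
cascadeVal-injective j [] (y ∷ ys) _ _ _ lb eq = contradiction eq (<⇒≢ (cascadeVal-positive j y ys lb))
cascadeVal-injective j (x ∷ xs) [] _ lb _ _ eq = contradiction (sym eq) (<⇒≢ (cascadeVal-positive j x xs lb))
cascadeVal-injective j (x ∷ xs) (y ∷ ys) x>xs lb y>ys lb′ eq with <-cmp x y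
... | tri< x<y _ _ = contradiction eq (<⇒≢ (cascadeVal-<-head j x xs y ys x>xs lb x<y))
... | tri> _ _ y<x = contradiction (sym eq) (<⇒≢ (cascadeVal-<-head j y ys x xs y>ys lb′ y<x))
cascadeVal-injective (suc t) (x ∷ xs) (x ∷ ys) x>xs lb x>ys lb′ eq | tri≈ _ refl _ =
  cong (x ∷_) (cascadeVal-injective t xs ys (Linked.tail x>xs) (proj₂ lb) (Linked.tail x>ys) (proj₂ lb′)
    (+-cancelˡ-≡ (x C suc t) _ _ eq))

cascadeVal<C⇒head< : ∀ n s xs → Linked _>_ xs → cascadeVal s xs < n C s → Linked _>_ (n ∷ xs)
cascadeVal<C⇒head< n s [] _ _ = [-]
cascadeVal<C⇒head< n s (x ∷ xs) x>xs val<C with n ≤? x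
... | yes n≤x = contradiction (≤-trans (C-monoˡ-≤ s n≤x) (cascadeVal-head s x xs)) (<⇒≱ val<C)
... | no n≰x = ≰⇒> n≰x ∷ x>xs

record SplitAt (b n : ℕ) (A C : List ℕ) : Set where
  field
    cover : ∀ x → (x ∈ A ⊎ x ∈ C) ⇔ (b ≤ x × x < n)
    common : ∀ x → x ∈ A → x ∈ C → x ≡ b
    size : length C + length A ≡ n ∸ b + 1

  ∈ˡ⇒< : ∀ {x} → x ∈ A → x < n
  ∈ˡ⇒< p = proj₂ (to (cover _) (inj₁ p))

  ∈ʳ⇒< : ∀ {x} → x ∈ C → x < n
  ∈ʳ⇒< p = proj₂ (to (cover _) (inj₂ p))

open SplitAt

split-singleton : ∀ n → SplitAt n (suc n) (n ∷ []) (n ∷ [])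
split-singleton n = record { cover = cover′ ; common = λ { _ (here refl) _ → refl } ; size = size′ }
  where
  cover′ : ∀ x → (x ∈ n ∷ [] ⊎ x ∈ n ∷ []) ⇔ (n ≤ x × x < suc n)
  cover′ x = mk⇔
    (λ { (inj₁ (here refl)) → ≤-refl , ≤-refl ; (inj₂ (here refl)) → ≤-refl , ≤-refl })
    (λ (n≤x , x<1+n) → inj₁ (here (≤-antisym (m<1+n⇒m≤n x<1+n) n≤x)))
  size′ : 2 ≡ suc n ∸ n + 1
  size′ = cong (_+ 1) (sym (trans (+-∸-assoc 1 (≤-refl {n})) (cong suc (n∸n≡0 n))))

range-suc : ∀ {b n x} → b ≤ x × x < suc n → (b ≤ x × x < n) ⊎ x ≡ n
range-suc (b≤x , x<1+n) = Sum.map₁ (b≤x ,_) (m<1+n⇒m<n∨m≡n x<1+n)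

range-weaken : ∀ {b n x} → b ≤ x × x < n → b ≤ x × x < suc n
range-weaken (b≤x , x<n) = b≤x , m<n⇒m<1+n x<n

size-suc : ∀ {b n} → b < n → suc (n ∸ b + 1) ≡ suc n ∸ b + 1
size-suc b<n = cong (_+ 1) (sym (+-∸-assoc 1 (<⇒≤ b<n)))

split-∷ˡ : ∀ {b n A C} → b ∈ A → SplitAt b n A C → SplitAt b (suc n) (n ∷ A) C
split-∷ˡ {b} {n} {A} {C} b∈A split = record { cover = cover′ ; common = common′ ; size = size′ }
  where
  b<n : b < n
  b<n = ∈ˡ⇒< split b∈A
  cover′ : ∀ x → (x ∈ n ∷ A ⊎ x ∈ C) ⇔ (b ≤ x × x < suc n)
  cover′ x = mk⇔
    (λ { (inj₁ (here refl)) → <⇒≤ b<n , ≤-refl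
       ; (inj₁ (there p)) → range-weaken (to (cover split x) (inj₁ p))
       ; (inj₂ q) → range-weaken (to (cover split x) (inj₂ q)) })
    back
    where
    back : b ≤ x × x < suc n → x ∈ n ∷ A ⊎ x ∈ C
    back r with range-suc r
    ... | inj₁ r′ = Sum.map₁ there (from (cover split x) r′)
    ... | inj₂ refl = inj₁ (here refl)
  common′ : ∀ x → x ∈ n ∷ A → x ∈ C → x ≡ b
  common′ x (here refl) q = contradiction (∈ʳ⇒< split q) (<-irrefl refl)
  common′ x (there p) q = common split x p q
  size′ : length C + suc (length A) ≡ suc n ∸ b + 1
  size′ = trans (+-suc (length C) (length A)) (trans (cong suc (size split)) (size-suc b<n))

split-∷ʳ : ∀ {b n A C} → b ∈ A → SplitAt b n A C → SplitAt b (suc n) A (n ∷ C)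
split-∷ʳ {b} {n} {A} {C} b∈A split = record { cover = cover′ ; common = common′ ; size = size′ }
  where
  b<n : b < n
  b<n = ∈ˡ⇒< split b∈A
  cover′ : ∀ x → (x ∈ A ⊎ x ∈ n ∷ C) ⇔ (b ≤ x × x < suc n)
  cover′ x = mk⇔
    (λ { (inj₁ p) → range-weaken (to (cover split x) (inj₁ p))
       ; (inj₂ (here refl)) → <⇒≤ b<n , ≤-refl
       ; (inj₂ (there q)) → range-weaken (to (cover split x) (inj₂ q)) })
    back
    where
    back : b ≤ x × x < suc n → x ∈ A ⊎ x ∈ n ∷ C
    back r with range-suc r
    ... | inj₁ r′ = Sum.map₂ there (from (cover split x) r′)
    ... | inj₂ refl = inj₂ (here refl)
  common′ : ∀ x → x ∈ A → x ∈ n ∷ C → x ≡ b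
  common′ x p (here refl) = contradiction (∈ˡ⇒< split p) (<-irrefl refl)
  common′ x p (there q) = common split x p q
  size′ : suc (length C + length A) ≡ suc n ∸ b + 1
  size′ = trans (cong suc (size split)) (size-suc b<n)

strictCascade-∷ : ∀ d x xs → 0 < d → d ≤ x → (∀ {y} → y ∈ xs → y < x) →
  StrictCascade (pred d) xs → StrictCascade d (x ∷ xs)
strictCascade-∷ (suc d) x [] _ d<x _ _ = [-] , s≤s z≤n , d<x , tt
strictCascade-∷ (suc d) x (y ∷ ys) _ d<x below (y>ys , len , lb) =
  below (here refl) ∷ y>ys , s≤s len , d<x , lb

cascadeVal-∷ : ∀ d x xs → 0 < d → cascadeVal d (x ∷ xs) ≡ x C d + cascadeVal (pred d) xs
cascadeVal-∷ (suc d) x xs _ = refl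

record Complement (n s : ℕ) (as : List ℕ) (b : ℕ) : Set where
  field
    cs : List ℕ
    cascade : StrictCascade (n ∸ s) (cs ∷ʳ b)
    sum : cascadeVal (n ∸ s) (cs ∷ʳ b) + cascadeVal s (as ∷ʳ b) ≡ n C s
    split : SplitAt b n (as ∷ʳ b) (cs ∷ʳ b)

complement-singleton : ∀ n s → s < n → Complement (suc n) (suc s) [] n
complement-singleton n s s<n = record
  { cs = []
  ; cascade = strictCascade-∷ (n ∸ s) n [] (m<n⇒0<n∸m s<n) (m∸n≤m n s) (λ ()) ([] , z≤n , tt)
  ; sum = sum
  ; split = split-singleton n
  }
  where
  open ≡-Reasoning
  sum : cascadeVal (n ∸ s) (n ∷ []) + cascadeVal (suc s) (n ∷ []) ≡ suc n C suc s
  sum = begin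
    cascadeVal (n ∸ s) (n ∷ []) + cascadeVal (suc s) (n ∷ [])
      ≡⟨ cong₂ _+_ (cascadeVal-∷ (n ∸ s) n [] (m<n⇒0<n∸m s<n)) refl ⟩
    n C (n ∸ s) + 0 + (n C suc s + 0)
      ≡⟨ cong₂ _+_ (+-identityʳ (n C (n ∸ s))) (+-identityʳ (n C suc s)) ⟩
    n C (n ∸ s) + n C suc s
      ≡⟨ cong (_+ n C suc s) (sym (nCk≡nC[n∸k] (<⇒≤ s<n))) ⟩
    n C s + n C suc s
      ≡⟨ nCk+nC[k+1]≡[n+1]C[k+1] n s ⟩
    suc n C suc s ∎

∈-∷ʳ : ∀ (xs : List ℕ) x → x ∈ xs ∷ʳ x
∈-∷ʳ xs x = ∈-++⁺ʳ xs (here refl)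

complement-∷ˡ : ∀ {n s as b} → Complement n s as b → Complement (suc n) (suc s) (n ∷ as) b
complement-∷ˡ {n} {s} {as} {b} c = record
  { cs = cs
  ; cascade = cascade
  ; sum = sum′
  ; split = split-∷ˡ (∈-∷ʳ as b) split
  }
  where
  open Complement c
  open ≡-Reasoning
  X : ℕ
  X = cascadeVal (n ∸ s) (cs ∷ʳ b)
  Y : ℕ
  Y = n C suc s
  Z : ℕ
  Z = cascadeVal s (as ∷ʳ b)
  sum′ : X + (Y + Z) ≡ suc n C suc s
  sum′ = begin
    X + (Y + Z)  ≡⟨ cong (X +_) (+-comm Y Z) ⟩
    X + (Z + Y)  ≡⟨ sym (+-assoc X Z Y) ⟩
    X + Z + Y    ≡⟨ cong (_+ Y) sum ⟩
    n C s + Y    ≡⟨ nCk+nC[k+1]≡[n+1]C[k+1] n s ⟩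
    suc n C suc s ∎

complement-∷ʳ : ∀ {n s as b} → suc s < n → Complement n (suc s) as b → Complement (suc n) (suc s) as b
complement-∷ʳ {n} {s} {as} {b} s<n c = record
  { cs = n ∷ cs
  ; cascade = strictCascade-∷ (n ∸ s) n (cs ∷ʳ b) 0<n∸s (m∸n≤m n s) (∈ʳ⇒< split)
      (subst (λ d → StrictCascade d (cs ∷ʳ b)) (sym (pred[m∸n]≡m∸[1+n] n s)) cascade)
  ; sum = sum′
  ; split = split-∷ʳ (∈-∷ʳ as b) split
  }
  where
  open Complement c
  open ≡-Reasoning
  0<n∸s : 0 < n ∸ s
  0<n∸s = m<n⇒0<n∸m (<-trans (n<1+n s) s<n)
  A : ℕ
  A = cascadeVal (suc s) (as ∷ʳ b)
  sum′ : cascadeVal (n ∸ s) (n ∷ cs ∷ʳ b) + A ≡ suc n C suc s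
  sum′ = begin
    cascadeVal (n ∸ s) (n ∷ cs ∷ʳ b) + A
      ≡⟨ cong (_+ A) (cascadeVal-∷ (n ∸ s) n (cs ∷ʳ b) 0<n∸s) ⟩
    n C (n ∸ s) + cascadeVal (pred (n ∸ s)) (cs ∷ʳ b) + A
      ≡⟨ +-assoc (n C (n ∸ s)) _ A ⟩
    n C (n ∸ s) + (cascadeVal (pred (n ∸ s)) (cs ∷ʳ b) + A)
      ≡⟨ cong (λ d → n C (n ∸ s) + (cascadeVal d (cs ∷ʳ b) + A)) (pred[m∸n]≡m∸[1+n] n s) ⟩
    n C (n ∸ s) + (cascadeVal (n ∸ suc s) (cs ∷ʳ b) + A)
      ≡⟨ cong (n C (n ∸ s) +_) sum ⟩
    n C (n ∸ s) + n C suc s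
      ≡⟨ cong (_+ n C suc s) (sym (nCk≡nC[n∸k] (≤-trans (n≤1+n s) (<⇒≤ s<n)))) ⟩
    n C s + n C suc s
      ≡⟨ nCk+nC[k+1]≡[n+1]C[k+1] n s ⟩
    suc n C suc s ∎

complement : ∀ n s as b → Linked _>_ (n ∷ as ∷ʳ b) → length (as ∷ʳ b) ≤ s →
  LowerBounds s (as ∷ʳ b) → Complement n s as b
complement zero s [] b (() ∷ _) _ _
complement zero s (a ∷ as) b (() ∷ _) _ _
complement (suc n) zero [] b _ _ ()
complement (suc n) zero (a ∷ as) b _ _ ()
complement (suc n) (suc s) [] b (s≤s b≤n ∷ [-]) len (s<b , tt) with m≤n⇒m<n∨m≡n b≤n
... | inj₂ refl = complement-singleton n s s<b
... | inj₁ b<n = complement-∷ʳ (≤-<-trans s<b b<n) (complement n (suc s) [] b (b<n ∷ [-]) len (s<b , tt))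
complement (suc n) (suc s) (a ∷ as) b (s≤s a≤n ∷ desc) len (s<a , lb) with m≤n⇒m<n∨m≡n a≤n
... | inj₂ refl = complement-∷ˡ (complement n s as b desc (≤-pred len) lb)
... | inj₁ a<n =
  complement-∷ʳ (≤-<-trans s<a a<n) (complement n (suc s) (a ∷ as) b (a<n ∷ desc) len (s<a , lb))

complement-unique : ∀ {n s as b} (c : Complement n s as b) ns → StrictCascade (n ∸ s) ns →
  cascadeVal (n ∸ s) ns ≡ n C s ∸ cascadeVal s (as ∷ʳ b) → ns ≡ Complement.cs c ∷ʳ b
complement-unique {n} {s} {as} {b} c ns (desc , _ , lb) val =
  cascadeVal-injective (n ∸ s) ns (cs ∷ʳ b) desc lb (proj₁ cascade) (proj₂ (proj₂ cascade))
    (trans val (trans (cong (_∸ a) (sym sum)) (m+n∸n≡m _ a)))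
  where
  open Complement c
  a : ℕ
  a = cascadeVal s (as ∷ʳ b)

corollary4p5 : (s n m : ℕ) → 1 ≤ s → s < n → 0 < m → m < n C s →
    (as : List ℕ) (b : ℕ) → StrictCascade s (as ∷ʳ b) → cascadeVal s (as ∷ʳ b) ≡ m →
    (ns' : List ℕ) → StrictCascade (n ∸ s) ns' → cascadeVal (n ∸ s) ns' ≡ n C s ∸ m →
    (∃ λ cs → ns' ≡ cs ∷ʳ b)
    × (∀ x → ((x ∈ (as ∷ʳ b) ⊎ x ∈ ns') ⇔ (b ≤ x × x < n)))
    × (∀ x → x ∈ (as ∷ʳ b) → x ∈ ns' → x ≡ b)
    × (length ns' + length (as ∷ʳ b) ≡ (n ∸ b) + 1)
-- The hypotheses 1 ≤ s, s < n and 0 < m are implied by the cascade data.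
corollary4p5 s n _ _ _ _ m<C as b (desc , len , lb) refl ns' sc′ val′
  with complement n s as b (cascadeVal<C⇒head< n s (as ∷ʳ b) desc m<C) len lb
... | c with complement-unique c ns' sc′ val′
... | refl = (Complement.cs c , refl) , cover split , common split , size split
  where open Complement c
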